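{- Let $G$ be a graph and $F\subseteq V(G)$ a fort of $G$. If $N_G[F]$ is not a zero forcing set of $G$, then $G$ admits a barbell partition.
   Context: All graphs are finite and simple. A fort of $G$ is a nonempty set $F\subseteq V(G)$ such that no vertex of $V(G)\setminus F$ is adjacent to exactly one vertex of $F$. $N_G[F]=F\cup\{u: u \text{ adjacent to some vertex of } F\}$. Zero forcing: starting with a set $S$ of blue vertices (others white), repeatedly apply the rule that a blue vertex with exactly one white neighbor turns that neighbor blue; $S$ is a zero forcing set if eventually all vertices become blue. A barbell partition of $G$ is a partition of $V(G)$ into three disjoint sets $\{R,W_1,W_2\}$ with $W_1,W_2\neq\emptyset$ ($R$ may be empty), no edges between $W_1$ and $W_2$, and $|N_G(r)\cap W_i|\neq 1$ for all $r\in R$, $i\in\{1,2\}$. -}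

module Defs where

open import Data.Nat using (ℕ)
open import Data.Bool using (Bool; true; false; _∨_; _∧_)
open import Data.Fin using (Fin)
open import Data.List using (allFin)
open import Data.Bool.ListAction using (any)
open import Data.Fin.Subset using (Subset; _∈_; _∉_; _∩_; _∪_; ∣_∣; ⁅_⁆; ⊤; Nonempty; ∁)
open import Data.Vec using (tabulate; lookup)
open import Data.Product using (Σ; _×_; ∃)
open import Data.Sum using (_⊎_)
open import Relation.Binary.PropositionalEquality using (_≡_; _≢_)
open import Relation.Nullary using (¬_)

record Graph (n : ℕ) : Set where
  field
    adj    : Fin n → Fin n → Bool
    sym    : ∀ u v → adj u v ≡ adj v u
    irrefl : ∀ v → adj v v ≡ false
open Graph public

Adj : ∀ {n} → Graph n → Fin n → Fin n → Set
Adj G u v = adj G u v ≡ true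

N : ∀ {n} → Graph n → Fin n → Subset n
N G v = tabulate (adj G v)

Nclosed : ∀ {n} → Graph n → Subset n → Subset n
Nclosed {n} G F = tabulate (λ u → lookup F u ∨ any (λ v → lookup F v ∧ adj G v u) (allFin n))

IsFort : ∀ {n} → Graph n → Subset n → Set
IsFort G F = Nonempty F × (∀ v → v ∉ F → ∣ N G v ∩ F ∣ ≢ 1)

-- One zero forcing step: blue u with exactly one white neighbour w turns w blue.
data ForceStep {n} (G : Graph n) (S : Subset n) : Subset n → Set where
  force : ∀ u w → u ∈ S → w ∈ N G u → w ∉ S → ∣ N G u ∩ ∁ S ∣ ≡ 1 →
          ForceStep G S (S ∪ ⁅ w ⁆)

data Forces {n} (G : Graph n) : Subset n → Subset n → Set where
  done : ∀ {S} → Forces G S S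
  step : ∀ {S T U} → ForceStep G S T → Forces G T U → Forces G S U

IsZeroForcingSet : ∀ {n} → Graph n → Subset n → Set
IsZeroForcingSet G S = Forces G S ⊤

record BarbellPartition {n} (G : Graph n) : Set where
  field
    R W₁ W₂   : Subset n
    cover     : ∀ v → v ∈ R × v ∉ W₁ × v ∉ W₂
                    ⊎ (v ∉ R × v ∈ W₁ × v ∉ W₂)
                    ⊎ (v ∉ R × v ∉ W₁ × v ∈ W₂)
    W₁-ne     : Nonempty W₁
    W₂-ne     : Nonempty W₂
    no-edge   : ∀ u v → u ∈ W₁ → v ∈ W₂ → ¬ Adj G u v
    R-cond₁   : ∀ r → r ∈ R → ∣ N G r ∩ W₁ ∣ ≢ 1
    R-cond₂   : ∀ r → r ∈ R → ∣ N G r ∩ W₂ ∣ ≢ 1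

{-# OPTIONS --safe #-}
module Submission where

-- Let the forcing process started from N[F] run until it stalls, at a set T ⊇ N[F].  As N[F] is
-- not zero forcing, some vertex lies outside T, and {T ∖ F, F, V ∖ T} is a barbell partition:
-- F has no neighbour outside N[F] ⊆ T, a vertex of T ∖ F sees either none or at least two
-- vertices of F because F is a fort, and it does not see exactly one vertex of V ∖ T because
-- otherwise it would force that vertex.

open import Defs hiding (sym)
open import Data.Nat using (zero; suc; _≤_; _<_; _≟_)
open import Data.Nat.Properties using (≤-trans; <-≤-trans; m<1+n⇒m≤n; n≮0)
open import Data.Fin using (Fin)
open import Data.Fin.Subset
open import Data.Fin.Subset.Properties
open import Data.Fin.Properties using (any?)
open import Data.Bool using (Bool; T; true; _∨_; _∧_)
open import Data.Bool.Properties using (T-≡; ∨-zeroʳ)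
open import Data.Bool.ListAction using (any)
open import Data.List using (allFin)
open import Data.List.Membership.Propositional using (lose)
open import Data.List.Membership.Propositional.Properties using (∈-allFin)
open import Data.List.Relation.Unary.Any.Properties using (any⁺)
open import Data.Vec using (tabulate; lookup)
open import Data.Vec.Properties using (lookup∘tabulate; []=⇒lookup; lookup⇒[]=)
open import Data.Product using (∃; _×_; _,_; proj₁; proj₂)
open import Data.Sum using (_⊎_; inj₁; inj₂)
open import Data.Empty using (⊥-elim)
open import Function.Base using (id; _∘_)
open import Function.Bundles using (Equivalence)
open import Relation.Binary.PropositionalEquality using (_≡_; _≢_; refl; sym; trans; cong; cong₂; subst)
open import Relation.Nullary using (¬_; yes; no)
open import Relation.Nullary.Decidable using (_×-dec_)

∣p∣≢0⇒Nonempty : ∀ {n} (p : Subset n) → ∣ p ∣ ≢ 0 → Nonempty p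
∣p∣≢0⇒Nonempty {n} p ∣p∣≢0 with nonempty? p
... | yes ne = ne
... | no ¬ne = ⊥-elim (∣p∣≢0 (trans (cong ∣_∣ (Empty-unique ¬ne)) (∣⊥∣≡0 n)))

p≢⊤⇒Nonempty∁p : ∀ {n} (p : Subset n) → p ≢ ⊤ → Nonempty (∁ p)
p≢⊤⇒Nonempty∁p p p≢⊤ with nonempty? (∁ p)
... | yes ne = ne
... | no ¬ne = ⊥-elim (p≢⊤ (⊆-antisym (λ _ → ∈⊤) (λ {x} _ → x∉∁p⇒x∈p (λ x∈∁p → ¬ne (x , x∈∁p)))))

x∈tabulate⁺ : ∀ {n} {f : Fin n → Bool} {x} → f x ≡ true → x ∈ tabulate f
x∈tabulate⁺ {f = f} {x} fx = lookup⇒[]= x _ (trans (lookup∘tabulate f x) fx)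

any-allFin⁺ : ∀ {n} (p : Fin n → Bool) x → p x ≡ true → any p (allFin n) ≡ true
any-allFin⁺ p x px =
  Equivalence.to T-≡ (any⁺ p (lose (∈-allFin x) (subst T (sym px) _)))

module _ {n} (G : Graph n) where

  F⊆Nclosed : ∀ {F} → F ⊆ Nclosed G F
  F⊆Nclosed {F} {u} u∈F =
    x∈tabulate⁺ (cong (_∨ any (λ v → lookup F v ∧ adj G v u) (allFin n)) ([]=⇒lookup u∈F))

  Adj⇒∈Nclosed : ∀ {F u v} → v ∈ F → Adj G v u → u ∈ Nclosed G F
  Adj⇒∈Nclosed {v = v} v∈F vu =
    x∈tabulate⁺ (trans (cong (_ ∨_) (any-allFin⁺ _ v (cong₂ _∧_ ([]=⇒lookup v∈F) vu))) (∨-zeroʳ _))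

  Stalled : Subset n → Set
  Stalled S = ∀ u → u ∈ S → ∣ N G u ∩ ∁ S ∣ ≢ 1

  forceStep : ∀ {S u} → u ∈ S → ∣ N G u ∩ ∁ S ∣ ≡ 1 →
              ∃ λ T → ForceStep G S T × S ⊆ T × ∣ ∁ T ∣ < ∣ ∁ S ∣
  forceStep {S} {u} u∈S one with ∣p∣≢0⇒Nonempty (N G u ∩ ∁ S) (subst (_≢ 0) (sym one) λ ())
  ... | w , w∈N∩∁S =
    S ∪ ⁅ w ⁆ , force u w u∈S w∈N w∉S one , proj₁ S⊂T , p⊂q⇒∣p∣<∣q∣ (p⊂q⇒∁p⊃∁q S⊂T)
    where
    w∈N : w ∈ N G u
    w∈N = proj₁ (x∈p∩q⁻ (N G u) (∁ S) w∈N∩∁S)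
    w∉S : w ∉ S
    w∉S = x∈∁p⇒x∉p (proj₂ (x∈p∩q⁻ (N G u) (∁ S) w∈N∩∁S))
    S⊂T : S ⊂ S ∪ ⁅ w ⁆
    S⊂T = p⊆p∪q ⁅ w ⁆ , w , x∈p∪q⁺ (inj₂ (x∈⁅x⁆ w)) , w∉S

  stalledClosure : ∀ k S → ∣ ∁ S ∣ ≤ k → ∃ λ T → S ⊆ T × Forces G S T × Stalled T
  stalledClosure zero S ∣∁S∣≤0 = S , id , done , λ u _ one →
    n≮0 (subst (_≤ 0) one (≤-trans (∣p∩q∣≤∣q∣ (N G u) (∁ S)) ∣∁S∣≤0))
  stalledClosure (suc k) S ∣∁S∣≤1+k with any? (λ u → (u ∈? S) ×-dec (∣ N G u ∩ ∁ S ∣ ≟ 1))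
  ... | no stuck = S , id , done , λ u u∈S one → stuck (u , u∈S , one)
  ... | yes (u , u∈S , one) with forceStep u∈S one
  ... | T , S→T , S⊆T , ∣∁T∣<∣∁S∣ with stalledClosure k T (m<1+n⇒m≤n (<-≤-trans ∣∁T∣<∣∁S∣ ∣∁S∣≤1+k))
  ... | U , T⊆U , T⇝U , U-stalled = U , T⊆U ∘ S⊆T , step S→T T⇝U , U-stalled

  fort-stalled⇒BarbellPartition : ∀ {F T} → IsFort G F → Nclosed G F ⊆ T → Stalled T →
                                  Nonempty (∁ T) → BarbellPartition G
  fort-stalled⇒BarbellPartition {F} {T} (F-ne , F-fort) N[F]⊆T T-stalled ∁T-ne = record
    { R = R ; W₁ = F ; W₂ = ∁ T
    ; cover = cover
    ; W₁-ne = F-ne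
    ; W₂-ne = ∁T-ne
    ; no-edge = λ u v u∈F v∈∁T uv → x∈∁p⇒x∉p v∈∁T (N[F]⊆T (Adj⇒∈Nclosed u∈F uv))
    ; R-cond₁ = λ r r∈R → F-fort r (x∈∁p⇒x∉p (proj₂ (x∈p∩q⁻ T (∁ F) r∈R)))
    ; R-cond₂ = λ r r∈R → T-stalled r (proj₁ (x∈p∩q⁻ T (∁ F) r∈R))
    }
    where
    R : Subset n
    R = T ∩ ∁ F
    ∉R : ∀ {v} → v ∈ F ⊎ v ∉ T → v ∉ R
    ∉R (inj₁ v∈F) v∈R = x∈∁p⇒x∉p (proj₂ (x∈p∩q⁻ T (∁ F) v∈R)) v∈F
    ∉R (inj₂ v∉T) v∈R = v∉T (proj₁ (x∈p∩q⁻ T (∁ F) v∈R))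
    cover : ∀ v → v ∈ R × v ∉ F × v ∉ ∁ T
                ⊎ (v ∉ R × v ∈ F × v ∉ ∁ T)
                ⊎ (v ∉ R × v ∉ F × v ∈ ∁ T)
    cover v with v ∈? F | v ∈? T
    ... | yes v∈F | _       = inj₂ (inj₁ (∉R (inj₁ v∈F) , v∈F , x∈p⇒x∉∁p (N[F]⊆T (F⊆Nclosed v∈F))))
    ... | no v∉F  | yes v∈T = inj₁ (x∈p∩q⁺ (v∈T , x∉p⇒x∈∁p v∉F) , v∉F , x∈p⇒x∉∁p v∈T)
    ... | no v∉F  | no v∉T  = inj₂ (inj₂ (∉R (inj₂ v∉T) , v∉F , x∉p⇒x∈∁p v∉T))

mainTheorem6 : ∀ {n} (G : Graph n) (F : Subset n) → IsFort G F →
    ¬ IsZeroForcingSet G (Nclosed G F) → BarbellPartition G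
mainTheorem6 G F fort ¬zf with stalledClosure G _ (Nclosed G F) (∣p∣≤n (∁ (Nclosed G F)))
... | T , N[F]⊆T , N[F]⇝T , T-stalled =
  fort-stalled⇒BarbellPartition G fort N[F]⊆T T-stalled
    (p≢⊤⇒Nonempty∁p T λ { refl → ¬zf N[F]⇝T })
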